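{- Let $M$ be a finite geometric semilattice with atom set $A$, and let $a_0$, $cM$ be as in the context. Define $c\ell$ on subsets $S\subseteq A\cup\{a_0\}$ by $c\ell(S)=A_{\bigvee S}$ if $a_0\notin S$ and $\bigvee S$ exists in $M$, and otherwise $c\ell(S)=\underline{A_t}$ where $t$ is any maximal element of $J(S\setminus\{a_0\})$. Then $c\ell$ is well defined (independent of the choice of $t$), takes values in $cM$, and satisfies: (a) $X\subseteq c\ell(X)$; (b) if $X\subseteq Y$ then $c\ell(X)\subseteq c\ell(Y)$; (c) $c\ell(X)=X$ for every $X\in cM$.
   Context: Geometric lattice: finite ranked lattice that is semimodular ($\operatorname{rank}(s)+\operatorname{rank}(t)\ge\operatorname{rank}(s\wedge t)+\operatorname{rank}(s\vee t)$) and atomistic (every element a join of atoms). Geometric semilattice: ranked meet semilattice $M$ such that (a) every principal order ideal is a geometric lattice, and (b) if $S$ is an independent set of atoms (i.e. $\bigvee S$ exists and $\operatorname{rank}(\bigvee S)=|S|$) and $\operatorname{rank}(t)<\operatorname{rank}(\bigvee S)$, then some $a\in S$ has $a\not\le t$ and $t\vee a$ exists. For $s\in M$: $A_s=\{a\in A:a\le s\}$, $P_s=\{a\in A: a,s \text{ have no common upper bound}\}$, $\underline{A_s}=A_s\cup P_s\cup\{a_0\}$ where $a_0$ is a new symbol. $cM=\{A_s:s\in M\}\cup\{\underline{A_s}:s\in M\}$ ordered by inclusion. For $S\subseteq A$, $J(S)$ is the subposet of $M$ consisting of all joins $\bigvee T$ that exist, for $T\subseteq S$ (with $\bigvee\emptyset=\hat0$).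 -}

module Defs where

open import Level using (0ℓ)
open import Data.Nat using (ℕ; zero; suc; _+_) renaming (_≤_ to _≤ℕ_; _<_ to _<ℕ_)
open import Data.Fin using (Fin; zero; suc)
open import Data.Fin.Subset using (Subset; _∈_; _∉_; _⊆_; ∣_∣)
open import Data.Product using (Σ; ∃; ∃-syntax; _×_; _,_)
open import Data.Sum using (_⊎_)
open import Data.Empty using (⊥)
open import Data.Unit using (⊤)
open import Relation.Nullary using (¬_)
open import Relation.Binary.PropositionalEquality using (_≡_)
open import Relation.Binary.Structures using (IsDecPartialOrder)
open import Function.Bundles using (_⇔_)

module Order {n : ℕ} (_≤_ : Fin n → Fin n → Set) where

  Pred : Set₁
  Pred = Fin n → Set

  IsLUBIn : Pred → Pred → Fin n → Set
  IsLUBIn Q P s = Q s × (∀ x → P x → x ≤ s)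
                      × (∀ u → Q u → (∀ x → P x → x ≤ u) → s ≤ u)

  IsGLBIn : Pred → Pred → Fin n → Set
  IsGLBIn Q P s = Q s × (∀ x → P x → s ≤ x)
                      × (∀ u → Q u → (∀ x → P x → u ≤ x) → u ≤ s)

  Whole : Pred
  Whole _ = ⊤

  IsLUB : Pred → Fin n → Set
  IsLUB = IsLUBIn Whole

  IsGLB : Pred → Fin n → Set
  IsGLB = IsGLBIn Whole

  pair : Fin n → Fin n → Pred
  pair x y z = (z ≡ x) ⊎ (z ≡ y)

  _<_ : Fin n → Fin n → Set
  x < y = (x ≤ y) × ¬ (x ≡ y)

  _⋖_ : Fin n → Fin n → Set
  x ⋖ y = (x < y) × (∀ z → x < z → ¬ (z < y))

  IsMinimal : Fin n → Set
  IsMinimal x = ∀ y → y ≤ x → y ≡ x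

  IsBottom : Fin n → Set
  IsBottom b = ∀ x → b ≤ x

  IsAtom : Fin n → Set
  IsAtom a = ∀ b → IsBottom b → b ⋖ a

  HaveUB : Fin n → Fin n → Set
  HaveUB x s = ∃[ u ] ((x ≤ u) × (s ≤ u))

  Ideal : Fin n → Pred
  Ideal s x = x ≤ s

record FiniteGeometricSemilattice (n : ℕ) : Set₁ where
  field
    _≤_ : Fin n → Fin n → Set
    isDecPartialOrder : IsDecPartialOrder _≡_ _≤_

  open Order _≤_ public

  field
    meet : ∀ x y → ∃[ m ] IsGLB (pair x y) m
    bot : Fin n
    bot-isBottom : IsBottom bot
    rank : Fin n → ℕ
    rank-min : ∀ x → IsMinimal x → rank x ≡ 0
    rank-cov : ∀ x y → x ⋖ y → rank y ≡ suc (rank x)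
    -- (a) every principal order ideal [0̂ , s] is a geometric lattice
    ideal-join : ∀ s x y → x ≤ s → y ≤ s →
      ∃[ j ] IsLUBIn (Ideal s) (pair x y) j
    ideal-semimodular : ∀ s x y j m → x ≤ s → y ≤ s →
      IsLUBIn (Ideal s) (pair x y) j → IsGLBIn (Ideal s) (pair x y) m →
      rank j + rank m ≤ℕ rank x + rank y
    ideal-atomistic : ∀ s x → x ≤ s →
      IsLUBIn (Ideal s) (λ a → IsAtom a × a ≤ s × a ≤ x) x
    -- (b) the independence augmentation axiom
    augment : ∀ (S : Subset n) j t → (∀ a → a ∈ S → IsAtom a) →
      IsLUB (λ a → a ∈ S) j → rank j ≡ ∣ S ∣ → rank t <ℕ rank j →
      ∃[ a ] (a ∈ S × ¬ (a ≤ t) × ∃[ u ] IsLUB (pair t a) u)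

-- The closure cℓ on subsets of A ∪ {a₀}.
-- Subsets of A ∪ {a₀} are represented as  Subset (suc n) :
-- index  zero  stands for the new symbol a₀, index  suc x  for x ∈ M.

module Closure {n : ℕ} (M : FiniteGeometricSemilattice n) where
  open FiniteGeometricSemilattice M

  a₀ : Fin (suc n)
  a₀ = zero

  Ground : Subset (suc n) → Set
  Ground S = ∀ x → suc x ∈ S → IsAtom x

  atomsOf : Subset (suc n) → Pred
  atomsOf S x = suc x ∈ S

  A[_] : Fin n → Fin (suc n) → Set
  A[ s ] zero = ⊥
  A[ s ] (suc a) = IsAtom a × a ≤ s

  A̲[_] : Fin n → Fin (suc n) → Set
  A̲[ s ] zero = ⊤
  A̲[ s ] (suc a) = IsAtom a × ((a ≤ s) ⊎ ¬ HaveUB a s)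

  _≐_ : Subset (suc n) → (Fin (suc n) → Set) → Set
  X ≐ P = ∀ p → (p ∈ X) ⇔ P p

  InCM : Subset (suc n) → Set
  InCM X = ∃[ s ] ((X ≐ A[ s ]) ⊎ (X ≐ A̲[ s ]))

  J : Pred → Pred
  J S' x = ∃[ T ] ((∀ a → a ∈ T → S' a) × IsLUB (λ a → a ∈ T) x)

  IsMaximalIn : Pred → Fin n → Set
  IsMaximalIn Q t = Q t × (∀ u → Q u → t ≤ u → u ≡ t)

  IsCl : Subset (suc n) → Subset (suc n) → Set
  IsCl S X =
      (a₀ ∉ S × ∃[ s ] (IsLUB (atomsOf S) s × (X ≐ A[ s ])))
    ⊎ (¬ (a₀ ∉ S × ∃[ s ] IsLUB (atomsOf S) s)
       × ∃[ t ] (IsMaximalIn (J (atomsOf S)) t × (X ≐ A̲[ t ])))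

{-# OPTIONS --safe #-}
-- Everything rests on a consequence of the augmentation axiom for two maximal elements t, x of J(Y):
-- they have the same rank, and an atom a ≰ t for which t ∨ a exists also satisfies a ≰ x with x ∨ a
-- existing.  So A̲_t does not depend on the choice of t, and monotonicity follows by passing to a
-- maximal element of J(Y) above the element defining cℓ(X).  Extensivity holds because a maximal
-- t ∈ J(Y) lies above every b ∈ Y with which it has a common upper bound, as t ∨ b ∈ J(Y).
module Submission where

open import Defs
open import Data.Nat using (ℕ; suc)
open import Data.Fin.Subset using (Subset; _⊆_)
open import Data.Product using (_×_; ∃-syntax)
open import Relation.Binary.PropositionalEquality using (_≡_)

open import Data.Bool using (T)
open import Data.Bool.Properties using (T-≡)
open import Data.Empty using (⊥-elim)
open import Data.Fin using (Fin; zero; suc) renaming (_≟_ to _≟ᶠ_)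
open import Data.Fin.Induction using (spo-wellFounded; spo-noetherian)
open import Data.Fin.Properties using (any?; all?)
open import Data.Fin.Subset using (_∈_; _∉_; ∣_∣; ⁅_⁆; _∪_; inside; outside) renaming (⊥ to ∅)
open import Data.Fin.Subset.Properties
  using (_∈?_; _⊆?_; ∉⊥; ⊥⊆; x∈⁅x⁆; p⊆p∪q; q⊆p∪q; ∣⊥∣≡0; ⊆-antisym; x∈⁅y⁆⇒x≡y; x∈p∪q⁻; ∪-identityʳ; anySubset?)
open import Data.Nat using (s≤s; _+_) renaming (_≤_ to _≤ℕ_; _<_ to _<ℕ_; _≟_ to _≟ℕ_)
import Data.Nat.Properties as ℕ
open import Data.Product using (_,_; proj₁; proj₂)
open import Data.Sum using (inj₁; inj₂; [_,_])
open import Data.Unit using (tt)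
open import Data.Vec.Base using (_∷_; tabulate; here; there)
open import Data.Vec.Properties using (lookup∘tabulate; []=⇒lookup; lookup⇒[]=)
open import Function using (_∘_; flip; id)
open import Function.Bundles using (mk⇔; Equivalence)
open import Induction.WellFounded using (Acc; acc)
import Relation.Binary.Construct.NonStrictToStrict as ToStrict
open import Relation.Binary.PropositionalEquality using (refl; sym; trans; cong; subst; module ≡-Reasoning)
open import Relation.Binary.Structures using (IsDecPartialOrder; IsStrictPartialOrder)
open import Relation.Nullary using (¬_; Dec; yes; no; contradiction)
open import Relation.Nullary.Decidable
  using (_×-dec_; _⊎-dec_; _→-dec_; ¬?; map′; isYes; toWitness; fromWitness; decidable-stable)
open import Relation.Unary using (Decidable)

module _ {m : ℕ} where

  fromDec : {P : Fin m → Set} → Decidable P → Subset m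
  fromDec P? = tabulate (isYes ∘ P?)

  ∈-fromDec⁺ : {P : Fin m → Set} (P? : Decidable P) → ∀ i → P i → i ∈ fromDec P?
  ∈-fromDec⁺ P? i p = lookup⇒[]= i _ (trans (lookup∘tabulate _ i) (Equivalence.to T-≡ (fromWitness p)))

  ∈-fromDec⁻ : {P : Fin m → Set} (P? : Decidable P) → ∀ i → i ∈ fromDec P? → P i
  ∈-fromDec⁻ P? i i∈ = toWitness {a? = P? i} (subst T (trans (sym ([]=⇒lookup i∈)) (lookup∘tabulate _ i)) tt)

  ∪⁅⁆-all : {P : Fin m → Set} {T : Subset m} {b : Fin m} →
            (∀ a → a ∈ T → P a) → P b → ∀ a → a ∈ T ∪ ⁅ b ⁆ → P a
  ∪⁅⁆-all {P} {T} {b} T⊆P Pb a a∈ with x∈p∪q⁻ T ⁅ b ⁆ a∈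
  ... | inj₁ a∈T = T⊆P a a∈T
  ... | inj₂ a∈⁅b⁆ = subst P (sym (x∈⁅y⁆⇒x≡y b a∈⁅b⁆)) Pb

∣p∪⁅x⁆∣≡1+∣p∣ : ∀ {m} (p : Subset m) {x : Fin m} → x ∉ p → ∣ p ∪ ⁅ x ⁆ ∣ ≡ suc ∣ p ∣
∣p∪⁅x⁆∣≡1+∣p∣ (inside ∷ p) {zero} x∉p = contradiction here x∉p
∣p∪⁅x⁆∣≡1+∣p∣ (outside ∷ p) {zero} _ = cong (suc ∘ ∣_∣) (∪-identityʳ p)
∣p∪⁅x⁆∣≡1+∣p∣ (inside ∷ p) {suc x} x∉p = cong suc (∣p∪⁅x⁆∣≡1+∣p∣ p (x∉p ∘ there))
∣p∪⁅x⁆∣≡1+∣p∣ (outside ∷ p) {suc x} x∉p = ∣p∪⁅x⁆∣≡1+∣p∣ p (x∉p ∘ there)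

module FiniteDecPoset {n : ℕ} {_≤_ : Fin n → Fin n → Set} (isDPO : IsDecPartialOrder _≡_ _≤_) where
  open Order _≤_
  open IsDecPartialOrder isDPO using (_≤?_; isPartialOrder) renaming (refl to ≤-refl; trans to ≤-trans)

  <-isStrictPartialOrder : IsStrictPartialOrder _≡_ _<_
  <-isStrictPartialOrder = ToStrict.<-isStrictPartialOrder _≡_ _≤_ isPartialOrder

  _<?_ : ∀ x y → Dec (x < y)
  x <? y = (x ≤? y) ×-dec ¬? (x ≟ᶠ y)

  maximal-above : {Q : Pred} → Decidable Q → ∀ {x} → Q x →
                  ∃[ u ] (x ≤ u × Q u × (∀ v → Q v → u ≤ v → v ≡ u))
  maximal-above {Q} Q? {x} = go (spo-noetherian <-isStrictPartialOrder x)
    where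
    go : ∀ {x} → Acc (flip _<_) x → Q x → ∃[ u ] (x ≤ u × Q u × (∀ v → Q v → u ≤ v → v ≡ u))
    go {x} (acc above) Qx with any? (λ u → Q? u ×-dec (x <? u))
    ... | yes (u , Qu , x<u) with go (above x<u) Qu
    ...   | v , u≤v , maxv = v , ≤-trans (proj₁ x<u) u≤v , maxv
    go {x} (acc above) Qx | no ∄ =
      x , ≤-refl , Qx , λ v Qv x≤v → sym (decidable-stable (x ≟ᶠ v) (λ x≢v → ∄ (v , Qv , x≤v , x≢v)))

  module _ (rank : Fin n → ℕ) (rank-cov : ∀ x y → x ⋖ y → rank y ≡ suc (rank x)) where

    -- A maximal element of {w | x ≤ w < y} is covered by y; induct downwards on y.
    rank-mono : ∀ {x y} → x < y → rank x <ℕ rank y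
    rank-mono {x} {y} = go (spo-wellFounded <-isStrictPartialOrder y)
      where
      go : ∀ {y} → Acc _<_ y → x < y → rank x <ℕ rank y
      go {y} (acc below) x<y with maximal-above (_<? y) x<y
      ... | z , x≤z , z<y , maxz = subst (rank x <ℕ_) (sym (rank-cov z y z⋖y)) (s≤s rank-x≤rank-z)
        where
        z⋖y : z ⋖ y
        z⋖y = z<y , λ w z<w w<y → proj₂ z<w (sym (maxz w w<y (proj₁ z<w)))
        rank-x≤rank-z : rank x ≤ℕ rank z
        rank-x≤rank-z with x ≟ᶠ z
        ... | yes refl = ℕ.≤-refl
        ... | no x≢z = ℕ.<⇒≤ (go (below z<y) (x≤z , x≢z))

module GeometricSemilatticeProperties {n : ℕ} (M : FiniteGeometricSemilattice n) where
  open FiniteGeometricSemilattice M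
  open Closure M using (J; IsMaximalIn)
  open IsDecPartialOrder isDecPartialOrder using (_≤?_; antisym) renaming (refl to ≤-refl; trans to ≤-trans)
  open FiniteDecPoset isDecPartialOrder using (_<?_; maximal-above; rank-mono)

  upper : ∀ {P s} → IsLUB P s → ∀ x → P x → x ≤ s
  upper (_ , ub , _) = ub

  least : ∀ {P s} → IsLUB P s → ∀ u → (∀ x → P x → x ≤ u) → s ≤ u
  least (_ , _ , l) u = l u tt

  LUB-unique : ∀ {P s s′} → IsLUB P s → IsLUB P s′ → s ≡ s′
  LUB-unique ls ls′ = antisym (least ls _ (upper ls′)) (least ls′ _ (upper ls))

  LUB-cong : ∀ {P Q : Pred} {s} → (∀ x → Q x → P x) → (∀ x → P x → Q x) → IsLUB P s → IsLUB Q s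
  LUB-cong Q⊆P P⊆Q ls = tt , (λ x → upper ls x ∘ Q⊆P x) , λ u _ Q≤u → least ls u (λ x → Q≤u x ∘ P⊆Q x)

  pair-all : ∀ {P : Pred} {x y} → P x → P y → ∀ z → pair x y z → P z
  pair-all Px Py _ (inj₁ refl) = Px
  pair-all Px Py _ (inj₂ refl) = Py

  pair-LUB⇒HaveUB : ∀ {t b u} → IsLUB (pair t b) u → HaveUB b t
  pair-LUB⇒HaveUB {u = u} lu = u , upper lu _ (inj₂ refl) , upper lu _ (inj₁ refl)

  _⊓_ : Fin n → Fin n → Fin n
  x ⊓ y = proj₁ (meet x y)

  ⊓-lower : ∀ x y z → pair x y z → (x ⊓ y) ≤ z
  ⊓-lower x y = proj₁ (proj₂ (proj₂ (meet x y)))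

  ⊓-greatest : ∀ x y u → (∀ z → pair x y z → u ≤ z) → u ≤ (x ⊓ y)
  ⊓-greatest x y u = proj₂ (proj₂ (proj₂ (meet x y))) u tt

  -- For an upper bound u of P, the element s ⊓ u of the ideal bounds P, so j ≤ s ⊓ u ≤ u.
  ideal-LUB⇒LUB : ∀ {s P j} → IsLUBIn (Ideal s) P j → IsLUB P j
  ideal-LUB⇒LUB {s} (j≤s , ub , l) = tt , ub , λ u _ P≤u →
    ≤-trans (l (s ⊓ u) (⊓-lower s u s (inj₁ refl))
                (λ x Px → ⊓-greatest s u x (pair-all (≤-trans (ub x Px) j≤s) (P≤u x Px))))
            (⊓-lower s u u (inj₂ refl))

  join : ∀ {x y u} → x ≤ u → y ≤ u → ∃[ j ] IsLUB (pair x y) j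
  join {x} {y} {u} x≤u y≤u with ideal-join u x y x≤u y≤u
  ... | j , lj = j , ideal-LUB⇒LUB lj

  LUB-∅ : IsLUB (_∈ ∅) bot
  LUB-∅ = tt , (λ _ x∈∅ → contradiction x∈∅ ∉⊥) , λ u _ _ → bot-isBottom u

  LUB-∪⁅⁆ : ∀ {T t b u} → IsLUB (_∈ T) t → IsLUB (pair t b) u → IsLUB (_∈ T ∪ ⁅ b ⁆) u
  LUB-∪⁅⁆ lt lu =
    tt , ∪⁅⁆-all (λ x x∈T → ≤-trans (upper lt x x∈T) (upper lu _ (inj₁ refl))) (upper lu _ (inj₂ refl)) ,
    λ v _ T∪b≤v → least lu v (pair-all (least lt v (λ x → T∪b≤v x ∘ p⊆p∪q _)) (T∪b≤v _ (q⊆p∪q _ _ (x∈⁅x⁆ _))))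

  atomistic : ∀ s → IsLUB (λ a → IsAtom a × a ≤ s) s
  atomistic s = LUB-cong (λ _ (at , a≤s) → at , a≤s , a≤s) (λ _ (at , a≤s , _) → at , a≤s)
                         (ideal-LUB⇒LUB (ideal-atomistic s s ≤-refl))

  rank-bot : rank bot ≡ 0
  rank-bot = rank-min bot (λ y y≤bot → antisym y≤bot (bot-isBottom y))

  rank-atom : ∀ {a} → IsAtom a → rank a ≡ 1
  rank-atom {a} at = trans (rank-cov bot a (at bot bot-isBottom)) (cong suc rank-bot)

  semimodular : ∀ {x y j} → IsLUB (pair x y) j → rank j + rank (x ⊓ y) ≤ℕ rank x + rank y
  semimodular {x} {y} {j} lj = ideal-semimodular j x y j (x ⊓ y) x≤j y≤j
    (≤-refl , upper lj , λ u _ → least lj u)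
    (≤-trans (⊓-lower x y x (inj₁ refl)) x≤j , ⊓-lower x y , λ u _ → ⊓-greatest x y u)
    where
    x≤j : x ≤ j
    x≤j = upper lj x (inj₁ refl)
    y≤j : y ≤ j
    y≤j = upper lj y (inj₂ refl)

  rank-join-atom : ∀ {t a j} → IsAtom a → ¬ a ≤ t → IsLUB (pair t a) j → rank j ≡ suc (rank t)
  rank-join-atom {t} {a} {j} at a≰t lj = ℕ.≤-antisym rank-j≤ (rank-mono rank rank-cov t<j)
    where
    open ℕ.≤-Reasoning
    t<j : t < j
    t<j = upper lj t (inj₁ refl) , λ t≡j → a≰t (subst (a ≤_) (sym t≡j) (upper lj a (inj₂ refl)))
    rank-j≤ : rank j ≤ℕ suc (rank t)
    rank-j≤ = begin
      rank j                 ≤⟨ ℕ.m≤m+n (rank j) (rank (t ⊓ a)) ⟩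
      rank j + rank (t ⊓ a)  ≤⟨ semimodular lj ⟩
      rank t + rank a        ≡⟨ cong (rank t +_) (rank-atom at) ⟩
      rank t + 1             ≡⟨ ℕ.+-comm (rank t) 1 ⟩
      suc (rank t)           ∎

  Independent : Subset n → Fin n → Set
  Independent I j = (∀ a → a ∈ I → IsAtom a) × IsLUB (_∈ I) j × rank j ≡ ∣ I ∣

  independent-∅ : Independent ∅ bot
  independent-∅ = (λ _ a∈∅ → contradiction a∈∅ ∉⊥) , LUB-∅ , trans rank-bot (sym (∣⊥∣≡0 n))

  independent-∪⁅⁆ : ∀ {I j a j′} → Independent I j → IsAtom a → ¬ a ≤ j → IsLUB (pair j a) j′ →
                    Independent (I ∪ ⁅ a ⁆) j′
  independent-∪⁅⁆ {I} {j} {a} {j′} (I-atoms , lj , rank-j) at a≰j lj′ =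
    ∪⁅⁆-all I-atoms at , LUB-∪⁅⁆ lj lj′ , (begin
      rank j′             ≡⟨ rank-join-atom at a≰j lj′ ⟩
      suc (rank j)        ≡⟨ cong suc rank-j ⟩
      suc ∣ I ∣           ≡⟨ ∣p∪⁅x⁆∣≡1+∣p∣ I (a≰j ∘ upper lj a) ⟨
      ∣ I ∪ ⁅ a ⁆ ∣       ∎)
    where open ≡-Reasoning

  isAtom? : Decidable IsAtom
  isAtom? a = map′ (λ bot⋖a b b-bottom → subst (_⋖ a) (antisym (bot-isBottom b) (b-bottom bot)) bot⋖a)
                   (λ at → at bot bot-isBottom)
                   ((bot <? a) ×-dec all? (λ z → (bot <? z) →-dec ¬? (z <? a)))

  isLUB? : ∀ {P} → Decidable P → Decidable (IsLUB P)
  isLUB? P? s = yes tt ×-dec all? (λ x → P? x →-dec x ≤? s)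
                       ×-dec all? (λ u → yes tt →-dec (all? (λ x → P? x →-dec x ≤? u) →-dec s ≤? u))

  independent? : ∀ I → Decidable (Independent I)
  independent? I j = all? (λ a → a ∈? I →-dec isAtom? a) ×-dec isLUB? (_∈? I) j ×-dec rank j ≟ℕ ∣ I ∣

  absorbed-by-maximal : ∀ {Q t b u} → IsMaximalIn Q t → IsLUB (pair t b) u → Q u → b ≤ t
  absorbed-by-maximal {t = t} {b} (_ , maxt) lu Qu =
    subst (b ≤_) (maxt _ Qu (upper lu t (inj₁ refl))) (upper lu b (inj₂ refl))

  -- A maximal independent subset of T must already span the join of T.
  basis : ∀ {T x} → (∀ a → a ∈ T → IsAtom a) → IsLUB (_∈ T) x → ∃[ I ] (I ⊆ T × Independent I x)
  basis {T} {x} T-atoms lx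
    with maximal-above (λ j → anySubset? (λ I → I ⊆? T ×-dec independent? I j)) (∅ , ⊥⊆ , independent-∅)
  ... | j , _ , maxj@((I , I⊆T , indI@(_ , lj , _)) , _) = I , I⊆T , subst (Independent I) j≡x indI
    where
    j≤x : j ≤ x
    j≤x = least lj x (λ a → upper lx a ∘ I⊆T)
    T≤j : ∀ b → b ∈ T → b ≤ j
    T≤j b b∈T with b ≤? j
    ... | yes b≤j = b≤j
    ... | no b≰j with join j≤x (upper lx b b∈T)
    ...   | j′ , lj′ = absorbed-by-maximal maxj lj′
                         (I ∪ ⁅ b ⁆ , (λ {a} → ∪⁅⁆-all (λ _ → I⊆T) b∈T a) ,
                          independent-∪⁅⁆ indI (T-atoms b b∈T) b≰j lj′)
    j≡x : j ≡ x
    j≡x = antisym j≤x (least lx j T≤j)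

  J? : ∀ {Y} → Decidable Y → Decidable (J Y)
  J? Y? x = anySubset? (λ T → all? (λ a → a ∈? T →-dec Y? a) ×-dec isLUB? (_∈? T) x)

  maximal-J-above : ∀ {Y x} → Decidable Y → J Y x → ∃[ t ] (x ≤ t × IsMaximalIn (J Y) t)
  maximal-J-above Y? = maximal-above (J? Y?)

  J-mono : ∀ {Y Z : Pred} {x} → (∀ a → Y a → Z a) → J Y x → J Z x
  J-mono Y⊆Z (T , T⊆Y , lx) = T , (λ a → Y⊆Z a ∘ T⊆Y a) , lx

  bot∈J : ∀ {Y} → J Y bot
  bot∈J = ∅ , (λ _ a∈∅ → contradiction a∈∅ ∉⊥) , LUB-∅

  LUB∈J : ∀ {Y s} → Decidable Y → IsLUB Y s → J Y s
  LUB∈J Y? ls = fromDec Y? , ∈-fromDec⁻ Y? , LUB-cong (∈-fromDec⁻ Y?) (∈-fromDec⁺ Y?) ls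

  maximal-J-absorbs : ∀ {Y t b} → IsMaximalIn (J Y) t → Y b → HaveUB b t → b ≤ t
  maximal-J-absorbs mt@((T , T⊆Y , lt) , _) b∈Y (u , b≤u , t≤u) with join t≤u b≤u
  ... | j , lj = absorbed-by-maximal mt lj (T ∪ ⁅ _ ⁆ , ∪⁅⁆-all T⊆Y b∈Y , LUB-∪⁅⁆ lt lj)

  maximal-J-isLUB : ∀ {Y t s} → IsMaximalIn (J Y) t → (∀ b → Y b → b ≤ s) → IsLUB Y t
  maximal-J-isLUB {s = s} mt@((T , T⊆Y , lt) , _) Y≤s =
    tt , (λ b b∈Y → maximal-J-absorbs mt b∈Y (s , Y≤s b b∈Y , least lt s (λ a → Y≤s a ∘ T⊆Y a))) ,
    λ u _ Y≤u → least lt u (λ a → Y≤u a ∘ T⊆Y a)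

  -- An element of J(Y) of larger rank would, by augmentation, offer an atom of Y
  -- joinable with t but not below it.
  J-rank≤maximal : ∀ {Y t x} → (∀ a → Y a → IsAtom a) → IsMaximalIn (J Y) t → J Y x → rank x ≤ℕ rank t
  J-rank≤maximal {t = t} {x} Y-atoms mt (U , U⊆Y , lx) with basis (λ a → Y-atoms a ∘ U⊆Y a) lx
  ... | I , I⊆U , (I-atoms , lI , rank-x) with rank x ℕ.≤? rank t
  ...   | yes rank-x≤rank-t = rank-x≤rank-t
  ...   | no rank-x≰rank-t with augment I x t I-atoms lI rank-x (ℕ.≰⇒> rank-x≰rank-t)
  ...     | b , b∈I , b≰t , _ , lu = ⊥-elim (b≰t (maximal-J-absorbs mt (U⊆Y b (I⊆U b∈I)) (pair-LUB⇒HaveUB lu)))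

  -- Augment x by a basis of t extended by a: the atom obtained cannot lie in Y, as x absorbs those.
  maximal-J-transfer : ∀ {Y t x a} → (∀ a → Y a → IsAtom a) → IsMaximalIn (J Y) t → IsMaximalIn (J Y) x →
                       IsAtom a → ¬ a ≤ t → HaveUB a t → ¬ a ≤ x × HaveUB a x
  maximal-J-transfer {x = x} {a} Y-atoms mt@((T , T⊆Y , lt) , _) mx at a≰t (u , a≤u , t≤u)
    with basis (λ b → Y-atoms b ∘ T⊆Y b) lt | join t≤u a≤u
  ... | I , I⊆T , indI | j , lj
    with independent-∪⁅⁆ indI at a≰t lj
  ... | I∪a-atoms , lI∪a , rank-j
    with augment (I ∪ ⁅ a ⁆) j x I∪a-atoms lI∪a rank-j rank-x<rank-j
    where
    rank-x<rank-j : rank x <ℕ rank j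
    rank-x<rank-j = subst (rank x <ℕ_) (sym (rank-join-atom at a≰t lj)) (s≤s (J-rank≤maximal Y-atoms mt (proj₁ mx)))
  ... | k , k∈I∪a , k≰x , _ , lv with x∈p∪q⁻ I ⁅ a ⁆ k∈I∪a
  ...   | inj₁ k∈I = ⊥-elim (k≰x (maximal-J-absorbs mx (T⊆Y k (I⊆T k∈I)) (pair-LUB⇒HaveUB lv)))
  ...   | inj₂ k∈⁅a⁆ with x∈⁅y⁆⇒x≡y a k∈⁅a⁆
  ...     | refl = k≰x , pair-LUB⇒HaveUB lv

module ClosureProperties {n : ℕ} (M : FiniteGeometricSemilattice n) where
  open FiniteGeometricSemilattice M
  open Closure M
  open GeometricSemilatticeProperties M
  open IsDecPartialOrder isDecPartialOrder using (_≤?_; antisym) renaming (trans to ≤-trans)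

  atomsOf? : ∀ S → Decidable (atomsOf S)
  atomsOf? S x = suc x ∈? S

  haveUB? : ∀ x s → Dec (HaveUB x s)
  haveUB? x s = any? (λ u → x ≤? u ×-dec s ≤? u)

  A? : ∀ s → Decidable A[ s ]
  A? s zero = no λ ()
  A? s (suc a) = isAtom? a ×-dec a ≤? s

  A̲? : ∀ s → Decidable A̲[ s ]
  A̲? s zero = yes tt
  A̲? s (suc a) = isAtom? a ×-dec (a ≤? s ⊎-dec ¬? (haveUB? a s))

  fromDec-≐ : ∀ {P} (P? : Decidable P) → fromDec P? ≐ P
  fromDec-≐ P? p = mk⇔ (∈-fromDec⁻ P? p) (∈-fromDec⁺ P? p)

  ≐⇒⊆ : ∀ {X Y P Q} → X ≐ P → Y ≐ Q → (∀ p → P p → Q p) → X ⊆ Y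
  ≐⇒⊆ X≐P Y≐Q P⊆Q {p} = Equivalence.from (Y≐Q p) ∘ P⊆Q p ∘ Equivalence.to (X≐P p)

  ≐⇒≡ : ∀ {X Y P Q} → X ≐ P → Y ≐ Q → (∀ p → P p → Q p) → (∀ p → Q p → P p) → X ≡ Y
  ≐⇒≡ X≐P Y≐Q P⊆Q Q⊆P = ⊆-antisym (≐⇒⊆ X≐P Y≐Q P⊆Q) (≐⇒⊆ Y≐Q X≐P Q⊆P)

  A⊆A̲ : ∀ s p → A[ s ] p → A̲[ s ] p
  A⊆A̲ s (suc a) (at , a≤s) = at , inj₁ a≤s

  A-mono : ∀ {s x} → s ≤ x → ∀ p → A[ s ] p → A[ x ] p
  A-mono s≤x (suc a) (at , a≤s) = at , ≤-trans a≤s s≤x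

  A̲-mono : ∀ {t x} → t ≤ x → ∀ p → A̲[ t ] p → A̲[ x ] p
  A̲-mono t≤x zero _ = tt
  A̲-mono t≤x (suc a) (at , inj₁ a≤t) = at , inj₁ (≤-trans a≤t t≤x)
  A̲-mono t≤x (suc a) (at , inj₂ ∄ub) = at , inj₂ λ (u , a≤u , x≤u) → ∄ub (u , a≤u , ≤-trans t≤x x≤u)

  A̲-maximal-⊆ : ∀ {Y t₁ t₂} → (∀ a → Y a → IsAtom a) → IsMaximalIn (J Y) t₁ → IsMaximalIn (J Y) t₂ →
                ∀ p → A̲[ t₁ ] p → A̲[ t₂ ] p
  A̲-maximal-⊆ _ _ _ zero _ = tt
  A̲-maximal-⊆ {t₂ = t₂} Y-atoms mt₁ mt₂ (suc a) (at , a∈A̲t₁) with a ≤? t₂ | haveUB? a t₂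
  ... | yes a≤t₂ | _ = at , inj₁ a≤t₂
  ... | no _ | no ∄ub = at , inj₂ ∄ub
  ... | no a≰t₂ | yes ub with maximal-J-transfer Y-atoms mt₂ mt₁ at a≰t₂ ub
  ...   | a≰t₁ , ub₁ = ⊥-elim ([ a≰t₁ , (λ ∄ub₁ → ∄ub₁ ub₁) ] a∈A̲t₁)

  A-isLUB : ∀ {X s} → X ≐ A[ s ] → IsLUB (atomsOf X) s
  A-isLUB {s = s} X≐ = LUB-cong (λ a → Equivalence.to (X≐ (suc a))) (λ a → Equivalence.from (X≐ (suc a))) (atomistic s)

  A̲-isMaximal : ∀ {X s} → X ≐ A̲[ s ] → IsMaximalIn (J (atomsOf X)) s
  A̲-isMaximal {X} {s} X≐ = s∈J , λ u (U , U⊆X , lu) s≤u → antisym (least lu s (U≤s U⊆X lu s≤u)) s≤u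
    where
    s∈J : J (atomsOf X) s
    s∈J = J-mono (λ a (at , a≤s) → Equivalence.from (X≐ (suc a)) (at , inj₁ a≤s))
                 (LUB∈J (λ a → isAtom? a ×-dec a ≤? s) (atomistic s))
    U≤s : ∀ {U u} → (∀ b → b ∈ U → atomsOf X b) → IsLUB (_∈ U) u → s ≤ u → ∀ b → b ∈ U → b ≤ s
    U≤s {u = u} U⊆X lu s≤u b b∈U with Equivalence.to (X≐ (suc b)) (U⊆X b b∈U)
    ... | _ , inj₁ b≤s = b≤s
    ... | _ , inj₂ ∄ub = ⊥-elim (∄ub (u , upper lu b b∈U , s≤u))

  cl-exists : ∀ S → ∃[ X ] IsCl S X
  cl-exists S with ¬? (a₀ ∈? S) ×-dec any? (isLUB? (atomsOf? S))
  ... | yes (a₀∉S , s , ls) = fromDec (A? s) , inj₁ (a₀∉S , s , ls , fromDec-≐ (A? s))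
  ... | no ¬joinable with maximal-J-above (atomsOf? S) bot∈J
  ...   | t , _ , mt = fromDec (A̲? t) , inj₂ (¬joinable , t , mt , fromDec-≐ (A̲? t))

  cl-unique : ∀ {S X Y} → Ground S → IsCl S X → IsCl S Y → X ≡ Y
  cl-unique _ (inj₁ (_ , s , ls , X≐)) (inj₁ (_ , s′ , ls′ , Y≐)) with LUB-unique ls ls′
  ... | refl = ≐⇒≡ X≐ Y≐ (λ _ → id) (λ _ → id)
  cl-unique _ (inj₁ (a₀∉S , s , ls , _)) (inj₂ (¬joinable , _)) = ⊥-elim (¬joinable (a₀∉S , s , ls))
  cl-unique _ (inj₂ (¬joinable , _)) (inj₁ (a₀∉S , s , ls , _)) = ⊥-elim (¬joinable (a₀∉S , s , ls))
  cl-unique G (inj₂ (_ , t₁ , mt₁ , X≐)) (inj₂ (_ , t₂ , mt₂ , Y≐)) =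
    ≐⇒≡ X≐ Y≐ (A̲-maximal-⊆ G mt₁ mt₂) (A̲-maximal-⊆ G mt₂ mt₁)

  cl-∈cM : ∀ {S X} → IsCl S X → InCM X
  cl-∈cM (inj₁ (_ , s , _ , X≐)) = s , inj₁ X≐
  cl-∈cM (inj₂ (_ , t , _ , X≐)) = t , inj₂ X≐

  cl-extensive : ∀ {X Y} → Ground X → IsCl X Y → X ⊆ Y
  cl-extensive _ (inj₁ (a₀∉X , _)) {zero} a₀∈X = contradiction a₀∈X a₀∉X
  cl-extensive G (inj₁ (_ , _ , ls , Y≐)) {suc a} a∈X = Equivalence.from (Y≐ (suc a)) (G a a∈X , upper ls a a∈X)
  cl-extensive _ (inj₂ (_ , _ , _ , Y≐)) {zero} _ = Equivalence.from (Y≐ zero) tt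
  cl-extensive G (inj₂ (_ , t , mt , Y≐)) {suc a} a∈X with haveUB? a t
  ... | yes ub = Equivalence.from (Y≐ (suc a)) (G a a∈X , inj₁ (maximal-J-absorbs mt a∈X ub))
  ... | no ∄ub = Equivalence.from (Y≐ (suc a)) (G a a∈X , inj₂ ∄ub)

  cl-monotone : ∀ {X Y X′ Y′} → Ground Y → X ⊆ Y → IsCl X X′ → IsCl Y Y′ → X′ ⊆ Y′
  cl-monotone _ X⊆Y (inj₁ (_ , s , ls , X′≐)) (inj₁ (_ , s′ , ls′ , Y′≐)) =
    ≐⇒⊆ X′≐ Y′≐ (A-mono (least ls s′ (λ a → upper ls′ a ∘ X⊆Y)))
  cl-monotone {X} {Y} GY X⊆Y (inj₁ (_ , s , ls , X′≐)) (inj₂ (_ , t , mt , Y′≐))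
    with maximal-J-above (atomsOf? Y) (J-mono (λ _ → X⊆Y) (LUB∈J (atomsOf? X) ls))
  ... | x , s≤x , mx = ≐⇒⊆ X′≐ Y′≐ (λ p → A̲-maximal-⊆ GY mx mt p ∘ A̲-mono s≤x p ∘ A⊆A̲ s p)
  cl-monotone _ X⊆Y (inj₂ (¬joinable , t , mt , _)) (inj₁ (a₀∉Y , s , ls , _)) =
    ⊥-elim (¬joinable (a₀∉Y ∘ X⊆Y , t , maximal-J-isLUB mt (λ a → upper ls a ∘ X⊆Y)))
  cl-monotone {Y = Y} GY X⊆Y (inj₂ (_ , t , mt , X′≐)) (inj₂ (_ , t′ , mt′ , Y′≐))
    with maximal-J-above (atomsOf? Y) (J-mono (λ _ → X⊆Y) (proj₁ mt))
  ... | x , t≤x , mx = ≐⇒⊆ X′≐ Y′≐ (λ p → A̲-maximal-⊆ GY mx mt′ p ∘ A̲-mono t≤x p)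

  cM-closed : ∀ {X Y} → InCM X → IsCl X Y → Y ≡ X
  cM-closed (s , inj₁ X≐) (inj₁ (_ , s′ , ls′ , Y≐)) with LUB-unique (A-isLUB X≐) ls′
  ... | refl = ≐⇒≡ Y≐ X≐ (λ _ → id) (λ _ → id)
  cM-closed (s , inj₁ X≐) (inj₂ (¬joinable , _)) = ⊥-elim (¬joinable (Equivalence.to (X≐ a₀) , s , A-isLUB X≐))
  cM-closed (s , inj₂ X≐) (inj₁ (a₀∉X , _)) = contradiction (Equivalence.from (X≐ a₀) tt) a₀∉X
  cM-closed {X} (s , inj₂ X≐) (inj₂ (_ , t , mt , Y≐)) =
    ≐⇒≡ Y≐ X≐ (A̲-maximal-⊆ X-atoms mt ms) (A̲-maximal-⊆ X-atoms ms mt)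
    where
    X-atoms : ∀ a → atomsOf X a → IsAtom a
    X-atoms a = proj₁ ∘ Equivalence.to (X≐ (suc a))
    ms : IsMaximalIn (J (atomsOf X)) s
    ms = A̲-isMaximal X≐

lemma5p4 : ∀ {n} (M : FiniteGeometricSemilattice n) → let open Closure M in
    -- well defined: a value exists, and it does not depend on the choice of t
    (∀ S → Ground S → ∃[ X ] IsCl S X)
    × (∀ S X Y → Ground S → IsCl S X → IsCl S Y → X ≡ Y)
    -- values lie in cM
    × (∀ S X → Ground S → IsCl S X → InCM X)
    -- (a) extensive
    × (∀ X Y → Ground X → IsCl X Y → X ⊆ Y)
    -- (b) monotone
    × (∀ X Y X' Y' → Ground X → Ground Y → X ⊆ Y → IsCl X X' → IsCl Y Y' → X' ⊆ Y')
    -- (c) elements of cM are closed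
    × (∀ X Y → InCM X → IsCl X Y → Y ≡ X)
lemma5p4 M =
  (λ S _ → cl-exists S) ,
  (λ _ _ _ → cl-unique) ,
  (λ _ _ _ → cl-∈cM) ,
  (λ _ _ → cl-extensive) ,
  (λ _ _ _ _ _ → cl-monotone) ,
  (λ _ _ → cM-closed)
  where open ClosureProperties M
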